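{- Let $j$ and $m$ be integers and $n$ a non-negative integer. Then for every complex number $z$, \[ \sum_{k=0}^n\binom{n}{k}F_{jk+m}B_{n-k}z^k=\frac{1}{\sqrt5}\Big(\alpha^mB_n(\alpha^jz)-\beta^mB_n(\beta^jz)\Big), \] \[ \sum_{k=0}^n\binom{n}{k}L_{jk+m}B_{n-k}z^k=\alpha^mB_n(\alpha^jz)+\beta^mB_n(\beta^jz). \]
   Context: $\alpha=\frac{1+\sqrt5}{2}$, $\beta=\frac{1-\sqrt5}{2}$. For every integer $s$, $F_s=\frac{\alpha^s-\beta^s}{\sqrt5}$ and $L_s=\alpha^s+\beta^s$ (Fibonacci and Lucas numbers extended to all integers). The Bernoulli polynomials $B_n(x)$ are defined by $\sum_{n\ge0}B_n(x)\frac{z^n}{n!}=\frac{ze^{xz}}{e^z-1}$, and $B_n=B_n(0)$ are the Bernoulli numbers. -}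

module Defs where

open import Level using (Level)
open import Data.Nat as ℕ using (ℕ; zero; suc)
open import Data.Nat.Combinatorics using (_C_)
open import Data.Fin using (Fin; toℕ) renaming (zero to fzero; suc to fsuc)
open import Data.Vec using (Vec; []; _∷_; lookup; last; _∷ʳ_)
open import Data.Integer as ℤ using (ℤ; +_; -[1+_])
open import Data.Rational as ℚ using (ℚ; 0ℚ; 1ℚ)
open import Data.Rational.Properties using (+-*-rawRing)
open import Algebra.Bundles using (CommutativeRing)
open import Algebra.Morphism.Structures using (module RingMorphisms)

-- Bernoulli numbers (rational), convention z/(e^z - 1), i.e. B₁ = -1/2.
-- Characterised by B₀ = 1 and Σ_{k=0}^{n} C(n+1,k) B_k = 0 for n ≥ 1,
-- which is the coefficient recursion of z/(e^z-1)·(e^z-1)/z = 1.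

sumFinℚ : (n : ℕ) → (Fin n → ℚ) → ℚ
sumFinℚ zero    f = 0ℚ
sumFinℚ (suc n) f = f fzero ℚ.+ sumFinℚ n (λ i → f (fsuc i))

bernoulliVec : (n : ℕ) → Vec ℚ (suc n)
bernoulliVec zero    = 1ℚ ∷ []
bernoulliVec (suc n) = bs ∷ʳ next
  where
  bs : Vec ℚ (suc n)
  bs = bernoulliVec n
  next : ℚ
  next = ℚ.- ((sumFinℚ (suc n) (λ k → ((+ ((suc (suc n)) C (toℕ k))) ℚ./ 1) ℚ.* lookup bs k))
              ℚ.* ((+ 1) ℚ./ suc (suc n)))

bernoulli : ℕ → ℚ
bernoulli n = last (bernoulliVec n)

-- Setting: a commutative ring R (e.g. ℂ) receiving ℚ via a ring
-- homomorphism ι, together with an element s with s² = 5 (s = √5).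

module Setting {c ℓ : Level} (R : CommutativeRing c ℓ) (ι : ℚ → CommutativeRing.Carrier R)
  (ιhom : RingMorphisms.IsRingHomomorphism +-*-rawRing (CommutativeRing.rawRing R) ι)
  (s : CommutativeRing.Carrier R) where

  open CommutativeRing R

  pow : Carrier → ℕ → Carrier
  pow x zero    = 1#
  pow x (suc n) = x * pow x n

  half fifth : Carrier
  half  = ι ((+ 1) ℚ./ 2)
  fifth = ι ((+ 1) ℚ./ 5)

  α β : Carrier
  α = half * (1# + s)
  β = half * (1# - s)

  -- 1/√5 = √5/5
  invSqrt5 : Carrier
  invSqrt5 = s * fifth

  -- integer powers; α⁻¹ = -β and β⁻¹ = -α (since αβ = -1)
  αpow βpow : ℤ → Carrier
  αpow (+ n)     = pow α n
  αpow -[1+ n ]  = pow (- β) (suc n)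
  βpow (+ n)     = pow β n
  βpow -[1+ n ]  = pow (- α) (suc n)

  F L : ℤ → Carrier
  F t = (αpow t - βpow t) * invSqrt5
  L t = αpow t + βpow t

  sumTo : ℕ → (ℕ → Carrier) → Carrier
  sumTo zero    f = f 0
  sumTo (suc n) f = sumTo n f + f (suc n)

  binom : ℕ → ℕ → Carrier
  binom n k = ι ((+ (n C k)) ℚ./ 1)

  Bn : ℕ → Carrier
  Bn n = ι (bernoulli n)

  -- Bernoulli polynomial B_n(x) = Σ_{k=0}^{n} C(n,k) B_{n-k} x^k
  -- (equivalent to the generating function z e^{xz}/(e^z-1))
  bernoulliPoly : ℕ → Carrier → Carrier
  bernoulliPoly n x = sumTo n (λ k → binom n k * Bn (n ℕ.∸ k) * pow x k)

{-# OPTIONS --safe #-}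
-- Since αβ = -1, α and β are units with α⁻¹ = -β and β⁻¹ = -α, so t ↦ α^t is a
-- homomorphism from (ℤ, +) and α^(jk+m) = α^m (α^j)^k.  Substituting Binet's
-- formulas F_t, L_t = c α^t + d β^t termwise therefore splits each sum into
-- c α^m Σ C(n,k) B_(n-k) (α^j z)^k + d β^m Σ C(n,k) B_(n-k) (β^j z)^k, which is
-- c α^m B_n(α^j z) + d β^m B_n(β^j z) by the expansion of B_n(x).
module Submission where

open import Defs
open import Level using (Level)
open import Data.Nat as ℕ using (ℕ; _∸_; zero; suc)
open import Data.Integer using (ℤ; +_; -[1+_]; _⊖_) renaming (_+_ to _+ℤ_; _*_ to _*ℤ_)
import Data.Integer.Properties as ℤ
import Data.Nat.Properties as ℕ
open import Data.Rational using (ℚ)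
import Data.Rational as ℚ
open import Data.Rational.Properties using (+-*-rawRing)
open import Data.Product using (_×_; _,_)
import Data.Maybe as Maybe
open import Relation.Nullary.Decidable using (dec⇒maybe)
open import Algebra.Bundles using (CommutativeRing)
open import Algebra.Morphism.Structures using (module RingMorphisms)
import Algebra.Solver.Ring.AlmostCommutativeRing as ACR
import Algebra.Solver.Ring as RingSolver
import Algebra.Properties.Ring as RingProperties
import Algebra.Properties.Semiring.Exp as SemiringExp
import Algebra.Properties.CommutativeSemiring.Exp as CommutativeSemiringExp
import Relation.Binary.Reasoning.Setoid as SetoidReasoning
open import Relation.Binary.PropositionalEquality as ≡ using (_≡_)

module _ {c ℓ : Level} (R : CommutativeRing c ℓ)
  (ι : ℚ → CommutativeRing.Carrier R)
  (ιhom : RingMorphisms.IsRingHomomorphism +-*-rawRing (CommutativeRing.rawRing R) ι)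
  (s : CommutativeRing.Carrier R) where

  open CommutativeRing R
  open Setting R ι ιhom s
  open RingMorphisms.IsRingHomomorphism ιhom
  open RingProperties ring using (-‿distribʳ-*; -‿involutive)
  open SemiringExp semiring using (_^_; ^-homo-*)
  open CommutativeSemiringExp commutativeSemiring using (^-distrib-*)
  open SetoidReasoning setoid

  ι-morphism : +-*-rawRing ACR.-Raw-AlmostCommutative⟶ ACR.fromCommutativeRing R
  ι-morphism = record
    { ⟦_⟧ = ι ; +-homo = +-homo ; *-homo = *-homo ; -‿homo = -‿homo
    ; 0-homo = 0#-homo ; 1-homo = 1#-homo }

  ι-≈? : ∀ a b → Maybe.Maybe (ι a ≈ ι b)
  ι-≈? a b = Maybe.map (λ a≡b → reflexive (≡.cong ι a≡b)) (dec⇒maybe (a ℚ.≟ b))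

  open RingSolver +-*-rawRing (ACR.fromCommutativeRing R) ι-morphism ι-≈?

  pow≡^ : ∀ x n → pow x n ≡ x ^ n
  pow≡^ x zero    = ≡.refl
  pow≡^ x (suc n) = ≡.cong (x *_) (pow≡^ x n)

  pow-homo-+ : ∀ x m n → pow x (m ℕ.+ n) ≈ pow x m * pow x n
  pow-homo-+ x m n rewrite pow≡^ x (m ℕ.+ n) | pow≡^ x m | pow≡^ x n = ^-homo-* x m n

  pow-distrib-* : ∀ x y n → pow (x * y) n ≈ pow x n * pow y n
  pow-distrib-* x y n rewrite pow≡^ (x * y) n | pow≡^ x n | pow≡^ y n = ^-distrib-* x y n

  sumTo-cong : ∀ n {f g : ℕ → Carrier} → (∀ k → f k ≈ g k) → sumTo n f ≈ sumTo n g
  sumTo-cong zero    f≈g = f≈g 0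
  sumTo-cong (suc n) f≈g = +-cong (sumTo-cong n f≈g) (f≈g (suc n))

  sumTo-+ : ∀ n (f g : ℕ → Carrier) → sumTo n (λ k → f k + g k) ≈ sumTo n f + sumTo n g
  sumTo-+ zero    f g = refl
  sumTo-+ (suc n) f g = trans (+-congʳ (sumTo-+ n f g))
    (solve 4 (λ a b c d → (a :+ b) :+ (c :+ d) := (a :+ c) :+ (b :+ d)) refl _ _ _ _)

  sumTo-*ˡ : ∀ n a (f : ℕ → Carrier) → sumTo n (λ k → a * f k) ≈ a * sumTo n f
  sumTo-*ˡ zero    a f = refl
  sumTo-*ˡ (suc n) a f = trans (+-congʳ (sumTo-*ˡ n a f)) (sym (distribˡ a _ _))

  module UnitPowers (x y : Carrier) (x*y≈1 : x * y ≈ 1#) where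

    zpow : ℤ → Carrier
    zpow (+ n)    = pow x n
    zpow -[1+ n ] = pow y (suc n)

    zpow-⊖ : ∀ m n → zpow (m ⊖ n) ≈ pow x m * pow y n
    zpow-⊖ m       zero    = sym (*-identityʳ _)
    zpow-⊖ zero    (suc n) = sym (*-identityˡ _)
    zpow-⊖ (suc m) (suc n) rewrite ℤ.[1+m]⊖[1+n]≡m⊖n m n = begin
      zpow (m ⊖ n)                      ≈⟨ zpow-⊖ m n ⟩
      pow x m * pow y n                 ≈⟨ *-identityˡ _ ⟨
      1# * (pow x m * pow y n)          ≈⟨ *-congʳ x*y≈1 ⟨
      (x * y) * (pow x m * pow y n)     ≈⟨ solve 4 (λ x y a b → (x :* y) :* (a :* b) := (x :* a) :* (y :* b)) refl x y _ _ ⟩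
      pow x (suc m) * pow y (suc n)     ∎

    zpow-homo-+ : ∀ a b → zpow (a +ℤ b) ≈ zpow a * zpow b
    zpow-homo-+ (+ m)    (+ n)    = pow-homo-+ x m n
    zpow-homo-+ (+ m)    -[1+ n ] = zpow-⊖ m (suc n)
    zpow-homo-+ -[1+ m ] (+ n)    = trans (zpow-⊖ n (suc m)) (*-comm _ _)
    zpow-homo-+ -[1+ m ] -[1+ n ] = begin
      pow y (suc (suc (m ℕ.+ n)))    ≡⟨ ≡.cong (λ t → pow y (suc t)) (ℕ.+-suc m n) ⟨
      pow y (suc m ℕ.+ suc n)        ≈⟨ pow-homo-+ y (suc m) (suc n) ⟩
      pow y (suc m) * pow y (suc n)  ∎

    zpow-*ℕ : ∀ a k → zpow (a *ℤ + k) ≈ pow (zpow a) k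
    zpow-*ℕ a zero    rewrite ℤ.*-zeroʳ a = refl
    zpow-*ℕ a (suc k) rewrite ℤ.*-suc a (+ k) =
      trans (zpow-homo-+ a (a *ℤ + k)) (*-congˡ (zpow-*ℕ a k))

    zpow-affine : ∀ j m k → zpow (j *ℤ + k +ℤ m) ≈ zpow m * pow (zpow j) k
    zpow-affine j m k = trans (zpow-homo-+ (j *ℤ + k) m) (trans (*-congʳ (zpow-*ℕ j k)) (*-comm _ _))

  bernoulliPoly-scaled : ∀ n (P : ℤ → Carrier) j m z →
    (∀ k → P (j *ℤ + k +ℤ m) ≈ P m * pow (P j) k) →
    sumTo n (λ k → binom n k * P (j *ℤ + k +ℤ m) * Bn (n ∸ k) * pow z k) ≈ P m * bernoulliPoly n (P j * z)
  bernoulliPoly-scaled n P j m z P-affine =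
    trans (sumTo-cong n term) (sumTo-*ˡ n (P m) (λ k → binom n k * Bn (n ∸ k) * pow (P j * z) k))
    where
    term : ∀ k → binom n k * P (j *ℤ + k +ℤ m) * Bn (n ∸ k) * pow z k
               ≈ P m * (binom n k * Bn (n ∸ k) * pow (P j * z) k)
    term k = begin
      binom n k * P (j *ℤ + k +ℤ m) * Bn (n ∸ k) * pow z k
        ≈⟨ *-congʳ (*-congʳ (*-congˡ (P-affine k))) ⟩
      binom n k * (P m * pow (P j) k) * Bn (n ∸ k) * pow z k
        ≈⟨ solve 5 (λ b p q B w → b :* (p :* q) :* B :* w := p :* (b :* B :* (q :* w))) refl _ _ _ _ _ ⟩
      P m * (binom n k * Bn (n ∸ k) * (pow (P j) k * pow z k))
        ≈⟨ *-congˡ (*-congˡ (pow-distrib-* (P j) z k)) ⟨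
      P m * (binom n k * Bn (n ∸ k) * pow (P j * z) k)  ∎

  binet-bernoulli : ∀ n (P Q G : ℤ → Carrier) a b j m z →
    (∀ k → P (j *ℤ + k +ℤ m) ≈ P m * pow (P j) k) →
    (∀ k → Q (j *ℤ + k +ℤ m) ≈ Q m * pow (Q j) k) →
    (∀ t → G t ≈ a * P t + b * Q t) →
    sumTo n (λ k → binom n k * G (j *ℤ + k +ℤ m) * Bn (n ∸ k) * pow z k)
      ≈ a * (P m * bernoulliPoly n (P j * z)) + b * (Q m * bernoulliPoly n (Q j * z))
  binet-bernoulli n P Q G a b j m z P-affine Q-affine G≈ = begin
    sumTo n (λ k → binom n k * G (t k) * Bn (n ∸ k) * pow z k)
      ≈⟨ sumTo-cong n term ⟩
    sumTo n (λ k → a * summand P k + b * summand Q k)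
      ≈⟨ sumTo-+ n _ _ ⟩
    sumTo n (λ k → a * summand P k) + sumTo n (λ k → b * summand Q k)
      ≈⟨ +-cong (sumTo-*ˡ n a _) (sumTo-*ˡ n b _) ⟩
    a * sumTo n (summand P) + b * sumTo n (summand Q)
      ≈⟨ +-cong (*-congˡ (bernoulliPoly-scaled n P j m z P-affine))
                (*-congˡ (bernoulliPoly-scaled n Q j m z Q-affine)) ⟩
    a * (P m * bernoulliPoly n (P j * z)) + b * (Q m * bernoulliPoly n (Q j * z))  ∎
    where
    t : ℕ → ℤ
    t k = j *ℤ + k +ℤ m
    summand : (ℤ → Carrier) → ℕ → Carrier
    summand H k = binom n k * H (t k) * Bn (n ∸ k) * pow z k
    term : ∀ k → binom n k * G (t k) * Bn (n ∸ k) * pow z k ≈ a * summand P k + b * summand Q k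
    term k = trans (*-congʳ (*-congʳ (*-congˡ (G≈ (t k)))))
      (solve 7 (λ B a p b q C w → B :* (a :* p :+ b :* q) :* C :* w
                                   := a :* (B :* p :* C :* w) :+ b :* (B :* q :* C :* w))
             refl _ _ _ _ _ _ _)

  module _ (s*s≈5 : s * s ≈ ι (+ 5 ℚ./ 1)) where

    α*β≈-1 : α * β ≈ - 1#
    α*β≈-1 = begin
      α * β
        ≈⟨ solve 3 (λ h o s → (h :* (o :+ s)) :* (h :* (o :- s)) := h :* h :* (o :* o :- s :* s)) refl half 1# s ⟩
      half * half * (1# * 1# - s * s)
        ≈⟨ *-congˡ (+-cong (trans (*-identityˡ 1#) (sym 1#-homo)) (-‿cong s*s≈5)) ⟩
      ι (+ 1 ℚ./ 2) * ι (+ 1 ℚ./ 2) * (ι ℚ.1ℚ - ι (+ 5 ℚ./ 1))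
        -- the constant (1/2)(1/2)(1 - 5) = -1 is computed in ℚ by the solver
        ≈⟨ solve 0 (con (+ 1 ℚ./ 2) :* con (+ 1 ℚ./ 2) :* (con ℚ.1ℚ :- con (+ 5 ℚ./ 1)) := :- con ℚ.1ℚ) refl ⟩
      - ι ℚ.1ℚ
        ≈⟨ -‿cong 1#-homo ⟩
      - 1#  ∎

    α*-β≈1 : α * - β ≈ 1#
    α*-β≈1 = trans (sym (-‿distribʳ-* α β)) (trans (-‿cong α*β≈-1) (-‿involutive 1#))

    β*-α≈1 : β * - α ≈ 1#
    β*-α≈1 = trans (sym (-‿distribʳ-* β α)) (trans (-‿cong (trans (*-comm β α) α*β≈-1)) (-‿involutive 1#))

    module Powα = UnitPowers α (- β) α*-β≈1
    module Powβ = UnitPowers β (- α) β*-α≈1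

    αpow≡zpow : ∀ t → αpow t ≡ Powα.zpow t
    αpow≡zpow (+ n)    = ≡.refl
    αpow≡zpow -[1+ n ] = ≡.refl

    βpow≡zpow : ∀ t → βpow t ≡ Powβ.zpow t
    βpow≡zpow (+ n)    = ≡.refl
    βpow≡zpow -[1+ n ] = ≡.refl

    αpow-affine : ∀ j m k → αpow (j *ℤ + k +ℤ m) ≈ αpow m * pow (αpow j) k
    αpow-affine j m k = begin
      αpow (j *ℤ + k +ℤ m)             ≡⟨ αpow≡zpow (j *ℤ + k +ℤ m) ⟩
      Powα.zpow (j *ℤ + k +ℤ m)        ≈⟨ Powα.zpow-affine j m k ⟩
      Powα.zpow m * pow (Powα.zpow j) k ≡⟨ ≡.cong₂ (λ a b → a * pow b k) (αpow≡zpow m) (αpow≡zpow j) ⟨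
      αpow m * pow (αpow j) k          ∎

    βpow-affine : ∀ j m k → βpow (j *ℤ + k +ℤ m) ≈ βpow m * pow (βpow j) k
    βpow-affine j m k = begin
      βpow (j *ℤ + k +ℤ m)             ≡⟨ βpow≡zpow (j *ℤ + k +ℤ m) ⟩
      Powβ.zpow (j *ℤ + k +ℤ m)        ≈⟨ Powβ.zpow-affine j m k ⟩
      Powβ.zpow m * pow (Powβ.zpow j) k ≡⟨ ≡.cong₂ (λ a b → a * pow b k) (βpow≡zpow m) (βpow≡zpow j) ⟨
      βpow m * pow (βpow j) k          ∎

    fibonacci-bernoulli : ∀ j m n z →
      sumTo n (λ k → binom n k * F (j *ℤ + k +ℤ m) * Bn (n ∸ k) * pow z k)
        ≈ invSqrt5 * (αpow m * bernoulliPoly n (αpow j * z) - βpow m * bernoulliPoly n (βpow j * z))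
    fibonacci-bernoulli j m n z =
      trans (binet-bernoulli n αpow βpow F invSqrt5 (- invSqrt5) j m z (αpow-affine j m) (βpow-affine j m) binet)
            (solve 3 (λ c x y → c :* x :+ (:- c) :* y := c :* (x :- y)) refl invSqrt5 _ _)
      where
      binet : ∀ t → F t ≈ invSqrt5 * αpow t + - invSqrt5 * βpow t
      binet t = solve 3 (λ x y c → (x :- y) :* c := c :* x :+ (:- c) :* y) refl (αpow t) (βpow t) invSqrt5

    lucas-bernoulli : ∀ j m n z →
      sumTo n (λ k → binom n k * L (j *ℤ + k +ℤ m) * Bn (n ∸ k) * pow z k)
        ≈ αpow m * bernoulliPoly n (αpow j * z) + βpow m * bernoulliPoly n (βpow j * z)
    lucas-bernoulli j m n z =
      trans (binet-bernoulli n αpow βpow L 1# 1# j m z (αpow-affine j m) (βpow-affine j m) binet)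
            (+-cong (*-identityˡ _) (*-identityˡ _))
      where
      binet : ∀ t → L t ≈ 1# * αpow t + 1# * βpow t
      binet t = sym (+-cong (*-identityˡ _) (*-identityˡ _))

corollary10 : ∀ {c ℓ : Level} (R : CommutativeRing c ℓ)
  (ι : ℚ → CommutativeRing.Carrier R)
  (ιhom : RingMorphisms.IsRingHomomorphism +-*-rawRing (CommutativeRing.rawRing R) ι)
  (s : CommutativeRing.Carrier R) →
  CommutativeRing._≈_ R (CommutativeRing._*_ R s s) (ι (+ 5 Data.Rational./ 1)) →
  let open CommutativeRing R
      open Setting R ι ιhom s
  in (j m : ℤ) (n : ℕ) (z : Carrier) →
     (sumTo n (λ k → binom n k * F (j *ℤ + k +ℤ m) * Bn (n ∸ k) * pow z k)
        ≈ invSqrt5 * (αpow m * bernoulliPoly n (αpow j * z) - βpow m * bernoulliPoly n (βpow j * z)))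
     ×
     (sumTo n (λ k → binom n k * L (j *ℤ + k +ℤ m) * Bn (n ∸ k) * pow z k)
        ≈ αpow m * bernoulliPoly n (αpow j * z) + βpow m * bernoulliPoly n (βpow j * z))
corollary10 R ι ιhom s s*s≈5 j m n z =
  fibonacci-bernoulli R ι ιhom s s*s≈5 j m n z , lucas-bernoulli R ι ιhom s s*s≈5 j m n z
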